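{- Let $\beta>2$ be an irrational number and let $S=\{\lfloor \beta n\rfloor \mid n\in\mathbb{Z}_{>0}\}$. Let $\alpha$ be defined by $\frac{1}{\alpha}+\frac{1}{\beta}=1$. Then a legal position $(x,y)$ of 2-pile $S$-Nim is a previous-player winning position (P-position) if and only if, up to swapping the two heaps, $(x,y)=(\lfloor\alpha n\rfloor,\lfloor\beta n\rfloor)$ for some $n\in\mathbb{Z}_{\ge 0}$.
   Context: Black \& white Nim: fix $S\subset\mathbb{Z}_{>0}$. Tokens in each heap are colored: for each heap, the $n$-th token from the bottom is black if $n\in S$ and white otherwise. A heap of size $h$ is called black if $h=0$ or $h\in S$ (i.e. its top token is black or it is empty), and white otherwise. In 2-pile $S$-Nim there are always exactly two heaps (empty heaps still count as heaps); a position is an unordered pair $(x,y)$ of nonnegative heap sizes, and a position is legal if at least one of its two heaps is black. Starting positions are required to be legal. Two players alternate; a move is a Nim move (remove a positive number of tokens from one heap) such that the resulting position is legal. The player who cannot move loses (normal play). A P-position is one from which the previous player (the one who just moved) wins with optimal play. -}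

module Defs where

open import Data.Nat using (ℕ; zero; suc; _∸_; _≤_; _<_)
open import Data.Integer using (+_)
open import Data.Rational using (ℚ; _/_) renaming (_<_ to _<ℚ_)
open import Data.Product using (_×_; ∃-syntax)
open import Data.Sum using (_⊎_)
open import Data.Empty using (⊥)
open import Relation.Binary.PropositionalEquality using (_≡_)

-- Irrational real numbers, as (two-sided) Dedekind cuts of ℚ.
-- Lower q means "q < x", Upper q means "x < q".
-- Irrationality (together with locatedness) is the field `total`:
-- every rational lies strictly below or strictly above x.

record IrrationalReal : Set₁ where
  field
    Lower        : ℚ → Set
    Upper        : ℚ → Set
    lower-inhab  : ∃[ q ] Lower q
    upper-inhab  : ∃[ q ] Upper q
    lower-closed : ∀ p q → p <ℚ q → Lower q → Lower p
    upper-closed : ∀ p q → p <ℚ q → Upper p → Upper q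
    lower-open   : ∀ q → Lower q → ∃[ r ] (q <ℚ r × Lower r)
    upper-open   : ∀ q → Upper q → ∃[ r ] (r <ℚ q × Upper r)
    disjoint     : ∀ q → Lower q → Upper q → ⊥
    total        : ∀ q → Lower q ⊎ Upper q

open IrrationalReal public

TwoLt : IrrationalReal → Set
TwoLt β = Lower β ((+ 2) / 1)

-- Floors of multiples of β:  FloorMulβ β n m  means  ⌊β n⌋ = m.
-- For n ≥ 1 (and β irrational, β > 0): m < β n < m + 1,
-- i.e. m/n < β < (m+1)/n.

FloorMulβ : IrrationalReal → ℕ → ℕ → Set
FloorMulβ β zero    m = m ≡ 0
FloorMulβ β (suc k) m = Lower β ((+ m) / suc k) × Upper β ((+ suc m) / suc k)

-- α with 1/α + 1/β = 1, i.e. α = β/(β-1) (β > 1).  We describe α by the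
-- rationals m/n (n ≥ 1) below / above it, unfolded in terms of β:
--   m/n < α  ⇔  β(m - n) < m  ⇔  m ≤ n, or (n < m and β < m/(m-n))
--   α < m/n  ⇔  m < β(m - n)  ⇔  n < m and m/(m-n) < β
-- (m - n = suc (m ∸ suc n) when n < m.)

LtAlpha : IrrationalReal → ℕ → ℕ → Set   -- LtAlpha β m n : m/n < α
LtAlpha β m n = m ≤ n ⊎ (n < m × Upper β ((+ m) / suc (m ∸ suc n)))

AlphaLt : IrrationalReal → ℕ → ℕ → Set   -- AlphaLt β m n : α < m/n
AlphaLt β m n = n < m × Lower β ((+ m) / suc (m ∸ suc n))

-- FloorMulα β n m  means  ⌊α n⌋ = m,  i.e. (n ≥ 1)  m/n < α < (m+1)/n.
FloorMulα : IrrationalReal → ℕ → ℕ → Set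
FloorMulα β zero    m = m ≡ 0
FloorMulα β (suc k) m = LtAlpha β m (suc k) × AlphaLt β (suc m) (suc k)

BeattyS : IrrationalReal → ℕ → Set
BeattyS β h = ∃[ k ] FloorMulβ β (suc k) h

Black : (ℕ → Set) → ℕ → Set
Black S h = h ≡ 0 ⊎ S h

Legal : (ℕ → Set) → ℕ → ℕ → Set
Legal S x y = Black S x ⊎ Black S y

data Move (S : ℕ → Set) : ℕ → ℕ → ℕ → ℕ → Set where
  left  : ∀ {x y x'} → x' < x → Legal S x' y → Move S x y x' y
  right : ∀ {x y y'} → y' < y → Legal S x y' → Move S x y x y'

data IsP (S : ℕ → Set) (x y : ℕ) : Set
data IsN (S : ℕ → Set) (x y : ℕ) : Set

data IsP S x y where
  allN : (∀ x' y' → Move S x y x' y' → IsN S x' y') → IsP S x y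

data IsN S x y where
  someP : ∀ x' y' → Move S x y x' y' → IsP S x' y' → IsN S x y

{-# OPTIONS --safe #-}
-- Since 1/α + 1/β = 1, the strictly increasing sequences ⌊αn⌋ and ⌊βn⌋ (n ≥ 1) partition ℤ_{>0}
-- (Beatty's theorem), so every h has exactly one partner p with {h, p} = {⌊αn⌋, ⌊βn⌋} for some
-- n ≥ 0.  These pairs form a kernel of the move graph.  A move keeps one heap, whose partner is
-- unique, so no move joins two pairs.  From any other position one lowers the heap that exceeds
-- the partner of the other heap; if neither does, then, as ⌊αn⌋ ≤ ⌊βn⌋ and both sequences
-- increase, neither heap can be 0 or some ⌊βk⌋, so the position is not legal.
module Submission where

open import Defs
open import Data.Nat using (ℕ; zero; suc; _+_; _*_; _∸_; _≤_; _<_; z≤n; s≤s; z<s; _≤?_; _<?_)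
open import Data.Nat.Properties
open import Data.Nat.Induction using (<-wellFounded)
open import Data.Nat.Tactic.RingSolver using (solve-∀)
open import Data.Integer as ℤ using (+_; -[1+_])
import Data.Integer.Properties as ℤ
open import Data.Rational using (ℚ; mkℚ; _/_; toℚᵘ)
import Data.Rational as ℚ
import Data.Rational.Properties as ℚ
import Data.Rational.Unnormalised as ℚᵘ
import Data.Rational.Unnormalised.Properties as ℚᵘ
open import Data.Product using (_×_; _,_; proj₁; proj₂; ∃-syntax)
open import Data.Sum using (_⊎_; inj₁; inj₂)
open import Data.Unit using (⊤; tt)
open import Data.Empty using (⊥; ⊥-elim)
open import Function.Base using (id)
open import Function.Bundles using (_⇔_; mk⇔)
open import Induction.WellFounded using (Acc; acc)
open import Relation.Nullary using (¬_; yes; no)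
open import Relation.Binary using (tri<; tri≈; tri>)
open import Relation.Binary.PropositionalEquality

private
  variable
    a b c d h j k m n p q x y x′ y′ : ℕ

frac : ℕ → ℕ → ℚ
frac a b = + a / suc b

private
  frac≃ : ∀ a b → toℚᵘ (frac a b) ℚᵘ.≃ ℚᵘ.mkℚᵘ (+ a) b
  frac≃ a b = ℚ.toℚᵘ-fromℚᵘ (ℚᵘ.mkℚᵘ (+ a) b)

  ↥*↧≡ : ∀ a b → + a ℤ.* + suc b ≡ + (a * suc b)
  ↥*↧≡ a b = sym (ℤ.pos-* a (suc b))

frac-mono-≤ : ∀ {a b c d} → a * suc d ≤ c * suc b → frac a b ℚ.≤ frac c d
frac-mono-≤ {a} {b} {c} {d} le = ℚ.toℚᵘ-cancel-≤
  (ℚᵘ.≤-respˡ-≃ (ℚᵘ.≃-sym (frac≃ a b)) (ℚᵘ.≤-respʳ-≃ (ℚᵘ.≃-sym (frac≃ c d))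
    (ℚᵘ.*≤* (subst₂ ℤ._≤_ (sym (↥*↧≡ a d)) (sym (↥*↧≡ c b)) (ℤ.+≤+ le)))))

frac-cancel-< : ∀ {a b c d} → frac a b ℚ.< frac c d → a * suc d < c * suc b
frac-cancel-< {a} {b} {c} {d} lt
  with ℚᵘ.<-respˡ-≃ (frac≃ a b) (ℚᵘ.<-respʳ-≃ (frac≃ c d) (ℚ.toℚᵘ-mono-< lt))
... | ℚᵘ.*<* lt′ = ℤ.drop‿+<+ (subst₂ ℤ._<_ (↥*↧≡ a d) (↥*↧≡ c b) lt′)

frac-unbounded : ∀ r → ∃[ N ] (r ℚ.< frac (suc N) 0)
frac-unbounded (mkℚ (+ N) d _) = N , frac-<-from-ℤ (ℤ.+<+ N*1<[1+N]*[1+d])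
  where
  frac-<-from-ℤ : + (N * 1) ℤ.< + (suc N * suc d) → mkℚ (+ N) d _ ℚ.< frac (suc N) 0
  frac-<-from-ℤ lt = ℚ.toℚᵘ-cancel-< (ℚᵘ.<-respʳ-≃ (ℚᵘ.≃-sym (frac≃ (suc N) 0))
    (ℚᵘ.*<* (subst₂ ℤ._<_ (sym (↥*↧≡ N 0)) (sym (↥*↧≡ (suc N) d)) lt)))
  N*1<[1+N]*[1+d] : N * 1 < suc N * suc d
  N*1<[1+N]*[1+d] = begin-strict
    N * 1         ≡⟨ *-identityʳ N ⟩
    N             <⟨ n<1+n N ⟩
    suc N         ≤⟨ m≤m*n (suc N) (suc d) ⟩
    suc N * suc d ∎
    where open ≤-Reasoning
frac-unbounded (mkℚ -[1+ N ] d _) = 0 , ℚ.toℚᵘ-cancel-<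
  (ℚᵘ.<-respʳ-≃ (ℚᵘ.≃-sym (frac≃ 1 0)) (ℚᵘ.*<* (subst (ℤ._<_ _) (sym (↥*↧≡ 1 d)) ℤ.-<+)))

module _ (x : IrrationalReal) where

  lower<upper : ∀ {r s} → Lower x r → Upper x s → r ℚ.< s
  lower<upper {r} {s} lr us with ℚ.<-cmp r s
  ... | tri< r<s _ _ = r<s
  ... | tri≈ _ refl _ = ⊥-elim (disjoint x r lr us)
  ... | tri> _ _ s<r = ⊥-elim (disjoint x r lr (upper-closed x s r s<r us))

  lower-upper-cross : ∀ a b c d → Lower x (frac a b) → Upper x (frac c d) → a * suc d < c * suc b
  lower-upper-cross a b c d l u = frac-cancel-< {a} {b} {c} {d} (lower<upper l u)

  lower-≤-closed : ∀ a b c d → a * suc d ≤ c * suc b → Lower x (frac c d) → Lower x (frac a b)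
  lower-≤-closed a b c d le l with lower-open x _ l
  ... | r , lt , lr = lower-closed x _ r (ℚ.≤-<-trans (frac-mono-≤ {a} {b} {c} {d} le) lt) lr

  upper-≤-closed : ∀ a b c d → a * suc d ≤ c * suc b → Upper x (frac a b) → Upper x (frac c d)
  upper-≤-closed a b c d le u with upper-open x _ u
  ... | r , lt , ur = upper-closed x r _ (ℚ.<-≤-trans lt (frac-mono-≤ {a} {b} {c} {d} le)) ur

crossing : {Lo Hi : ℕ → Set} → (∀ a → Lo a ⊎ Hi a) → Lo 0 → ∀ N → Hi (suc N) →
           ∃[ a ] (Lo a × Hi (suc a))
crossing total lo₀ zero    hi = 0 , lo₀ , hi
crossing total lo₀ (suc N) hi with total (suc N)
... | inj₁ lo  = suc N , lo , hi
... | inj₂ hi′ = crossing total lo₀ N hi′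

a*n<[1+c]*m⇒a<c : m < n → n ≤ c → a * n < suc c * m → a < c
a*n<[1+c]*m⇒a<c {m} {n} {c} {a} m<n n≤c a*n<[1+c]*m with a <? c
... | yes a<c = a<c
... | no a≮c = ⊥-elim (<-irrefl refl (begin-strict
  m + c * m  <⟨ +-monoˡ-< (c * m) m<n ⟩
  n + c * m  ≤⟨ +-monoˡ-≤ (c * m) n≤c ⟩
  c + c * m  ≡⟨ *-suc c m ⟨
  c * suc m  ≤⟨ *-monoʳ-≤ c m<n ⟩
  c * n      ≤⟨ *-monoˡ-≤ n (≮⇒≥ a≮c) ⟩
  a * n      <⟨ a*n<[1+c]*m ⟩
  m + c * m  ∎))
  where open ≤-Reasoning

-- F is the graph of n ↦ ⌊γ n⌋ for a real γ ≥ 1 given by its cuts: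
-- Lo a b means a/(b+1) < γ and Up a b means γ < a/(b+1).
module FloorGraph
  (Lo Up : ℕ → ℕ → Set)
  (cross : ∀ {a b c d} → Lo a b → Up c d → a * suc d < c * suc b)
  (F : ℕ → ℕ → Set)
  (F-zero : ∀ {a} → F zero a → a ≡ 0)
  (F-suc : ∀ {k a} → F (suc k) a → Lo a k × Up (suc a) k)
  (F-≥ : ∀ {k a} → F (suc k) a → suc k ≤ a)
  where

  unique : F n a → F n b → a ≡ b
  unique {zero} fa fb = trans (F-zero fa) (sym (F-zero fb))
  unique {suc k} fa fb = ≤-antisym (floor≤floor fa fb) (floor≤floor fb fa)
    where
    floor≤floor : F (suc k) a → F (suc k) b → a ≤ b
    floor≤floor {a} {b} fa fb =
      ≤-pred (*-cancelʳ-< (suc k) a (suc b) (cross (proj₁ (F-suc fa)) (proj₂ (F-suc fb))))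

  strictMono : m < n → F m a → F n b → a < b
  strictMono {zero} {suc n} {b = b} _ fa fb =
    subst (_< b) (sym (F-zero fa)) (≤-trans (s≤s z≤n) (F-≥ fb))
  strictMono {suc m} {suc n} m<n fa fb =
    a*n<[1+c]*m⇒a<c m<n (F-≥ fb) (cross (proj₁ (F-suc fa)) (proj₂ (F-suc fb)))

  injective : F m a → F n a → m ≡ n
  injective {m} {n = n} fm fn with <-cmp m n
  ... | tri< m<n _ _ = ⊥-elim (<-irrefl refl (strictMono m<n fm fn))
  ... | tri≈ _ m≡n _ = m≡n
  ... | tri> _ _ n<m = ⊥-elim (<-irrefl refl (strictMono n<m fn fm))

  monotone : m ≤ n → F m a → F n b → a ≤ b
  monotone m≤n fa fb with m≤n⇒m<n∨m≡n m≤n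
  ... | inj₁ m<n  = <⇒≤ (strictMono m<n fa fb)
  ... | inj₂ refl = ≤-reflexive (unique fa fb)

module _ {S : ℕ → Set} where

  move-legal : Move S x y x′ y′ → Legal S x′ y′
  move-legal (left  _ legal) = legal
  move-legal (right _ legal) = legal

  move-decreasing : Move S x y x′ y′ → x′ + y′ < x + y
  move-decreasing {y = y} (left  x′<x _) = +-monoˡ-< y x′<x
  move-decreasing {x = x} (right y′<y _) = +-monoʳ-< x y′<y

  IsP∧IsN⇒⊥ : IsP S x y → IsN S x y → ⊥
  IsP∧IsN⇒⊥ (allN next) (someP x′ y′ mv p) = IsP∧IsN⇒⊥ p (next x′ y′ mv)

-- K is a kernel of the move graph; since moves decrease x + y, it is exactly the set of P-positions.
module Kernel
  (S : ℕ → Set)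
  (K : ℕ → ℕ → Set)
  (independent : ∀ {x y x′ y′} → K x y → Move S x y x′ y′ → ¬ K x′ y′)
  (absorbing : ∀ {x y} → Legal S x y → K x y ⊎ ∃[ x′ ] ∃[ y′ ] (Move S x y x′ y′ × K x′ y′))
  where

  kernel⇒IsP : Acc _<_ (x + y) → K x y → IsP S x y
  kernel⇒IsP {x} {y} (acc rec) k = allN reply
    where
    reply : ∀ x′ y′ → Move S x y x′ y′ → IsN S x′ y′
    reply x′ y′ mv with absorbing (move-legal mv)
    ... | inj₁ k′ = ⊥-elim (independent k mv k′)
    ... | inj₂ (x″ , y″ , mv′ , k″) =
      someP x″ y″ mv′ (kernel⇒IsP (rec (<-trans (move-decreasing mv′) (move-decreasing mv))) k″)

  IsP⇔kernel : Legal S x y → IsP S x y ⇔ K x y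
  IsP⇔kernel {x} {y} legal = mk⇔ IsP⇒kernel (kernel⇒IsP (<-wellFounded (x + y)))
    where
    IsP⇒kernel : IsP S x y → K x y
    IsP⇒kernel isP with absorbing legal
    ... | inj₁ k = k
    ... | inj₂ (x′ , y′ , mv , k′) =
      ⊥-elim (IsP∧IsN⇒⊥ isP (someP x′ y′ mv (kernel⇒IsP (<-wellFounded _) k′)))

module Beatty (β : IrrationalReal) (2<β : TwoLt β) where

  ⌊β⌋-≥-2n : FloorMulβ β (suc k) b → 2 * suc k ≤ b
  ⌊β⌋-≥-2n {k} {b} (_ , u) =
    ≤-pred (subst (2 * suc k <_) (*-identityʳ (suc b)) (lower-upper-cross β 2 0 (suc b) k 2<β u))

  ⌊β⌋-≥ : FloorMulβ β (suc k) b → suc k ≤ b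
  ⌊β⌋-≥ {k} fb = ≤-trans (m≤m+n (suc k) (suc k + 0)) (⌊β⌋-≥-2n fb)

  ⌊β⌋-exists : ∀ n → ∃[ b ] FloorMulβ β n b
  ⌊β⌋-exists zero = 0 , refl
  ⌊β⌋-exists (suc k) with upper-inhab β
  ... | r , β<r with frac-unbounded r
  ...   | N , r<N+1 = crossing (λ a → total β (frac a k))
    (lower-≤-closed β 0 k 2 0 z≤n 2<β) (k + N * suc k)
    (upper-≤-closed β (suc N) 0 (suc N * suc k) k (≤-reflexive (sym (*-identityʳ _)))
      (upper-closed β r _ r<N+1 β<r))

  open FloorGraph (λ a b → Lower β (frac a b)) (λ c d → Upper β (frac c d))
                  (λ {a} {b} {c} {d} → lower-upper-cross β a b c d)
                  (FloorMulβ β) id id ⌊β⌋-≥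
    using () renaming (unique to ⌊β⌋-unique; injective to ⌊β⌋-injective; strictMono to ⌊β⌋-strictMono)

  α-total : ∀ a → LtAlpha β a n ⊎ AlphaLt β a n
  α-total {n} a with a ≤? n
  ... | yes a≤n = inj₁ (inj₁ a≤n)
  ... | no a≰n with total β (frac a (a ∸ suc n))
  ...   | inj₁ lo = inj₂ (≰⇒> a≰n , lo)
  ...   | inj₂ up = inj₁ (inj₂ (≰⇒> a≰n , up))

  α<2 : AlphaLt β (suc n + suc n) (suc n)
  α<2 {n} = m<m+n (suc n) z<s ,
    subst (λ t → Lower β (frac (suc n + suc n) t)) (sym (m+n∸n≡m n (suc n)))
      (lower-≤-closed β (suc n + suc n) n 2 0 (≤-reflexive (2n*1≡2*n n)) 2<β)
    where
    2n*1≡2*n : ∀ n → (suc n + suc n) * 1 ≡ 2 * suc n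
    2n*1≡2*n = solve-∀

  α-cross : LtAlpha β a (suc b) → AlphaLt β c (suc d) → a * suc d < c * suc b
  α-cross {a} {b} {c} {d} (inj₁ a≤1+b) (1+d<c , _) = begin-strict
    a * suc d      ≤⟨ *-monoˡ-≤ (suc d) a≤1+b ⟩
    suc b * suc d  ≡⟨ *-comm (suc b) (suc d) ⟩
    suc d * suc b  <⟨ *-monoˡ-< (suc b) 1+d<c ⟩
    c * suc b      ∎
    where open ≤-Reasoning
  α-cross {a} {b} {c} {d} (inj₂ (1+b<a , β<a/[a-1-b])) (1+d<c , c/[c-1-d]<β) =
    via-β _ _ (m+[n∸m]≡n 1+b<a) (m+[n∸m]≡n 1+d<c) β<a/[a-1-b] c/[c-1-d]<β
    where
    -- t ↦ t/(t − 1) is decreasing: with m = p+1+j and m′ = q+1+j′,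
    -- m′/(j′+1) < m/(j+1) gives m/p < m′/q.
    complement : ∀ p q j j′ → (suc q + j′) * suc j < (suc p + j) * suc j′ →
                 (suc p + j) * q < (suc q + j′) * p
    complement p q j j′ lt = subst₂ _<_ (e₃ p q j) (e₄ p q j′) (+-monoʳ-< (q * p) core)
      where
      e₁ : ∀ q j j′ → (suc q + j′) * suc j ≡ q * suc j + suc j′ * suc j
      e₁ = solve-∀
      e₂ : ∀ p j j′ → (suc p + j) * suc j′ ≡ p * suc j′ + suc j′ * suc j
      e₂ = solve-∀
      e₃ : ∀ p q j → q * p + q * suc j ≡ (suc p + j) * q
      e₃ = solve-∀
      e₄ : ∀ p q j′ → q * p + p * suc j′ ≡ (suc q + j′) * p
      e₄ = solve-∀
      core : q * suc j < p * suc j′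
      core = +-cancelʳ-< (suc j′ * suc j) _ _ (subst₂ _<_ (e₁ q j j′) (e₂ p j j′) lt)
    via-β : ∀ s t → suc (suc b) + s ≡ a → suc (suc d) + t ≡ c →
            Upper β (frac a s) → Lower β (frac c t) → a * suc d < c * suc b
    via-β s t refl refl up lo =
      complement (suc b) (suc d) s t (lower-upper-cross β (suc (suc d) + t) t (suc (suc b) + s) s lo up)

  ⌊α⌋-≥ : FloorMulα β (suc k) a → suc k ≤ a
  ⌊α⌋-≥ (_ , 1+k<1+a , _) = ≤-pred 1+k<1+a

  ⌊α⌋-exists : ∀ n → ∃[ a ] FloorMulα β n a
  ⌊α⌋-exists zero    = 0 , refl
  ⌊α⌋-exists (suc n) = crossing α-total (inj₁ z≤n) (n + suc n) α<2

  open FloorGraph (λ a b → LtAlpha β a (suc b)) (λ c d → AlphaLt β c (suc d)) α-cross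
                  (FloorMulα β) id id ⌊α⌋-≥
    using () renaming (unique to ⌊α⌋-unique; injective to ⌊α⌋-injective; monotone to ⌊α⌋-monotone)

  -- β < h / j, where h / 0 = ∞
  βBelow : ℕ → ℕ → Set
  βBelow h zero    = ⊤
  βBelow h (suc j) = Upper β (frac h j)

  ⌊α⌋-intro : ∀ j → βBelow (j + suc n) j → Lower β (frac (suc (j + suc n)) j) →
              FloorMulα β (suc n) (j + suc n)
  ⌊α⌋-intro {n} j β<h/j lo =
    lt-α j β<h/j , s≤s (m≤n+m (suc n) j) ,
    subst (λ t → Lower β (frac (suc (j + suc n)) t)) (sym (m+n∸n≡m j (suc n))) lo
    where
    lt-α : ∀ j → βBelow (j + suc n) j → LtAlpha β (j + suc n) (suc n)
    lt-α zero    _  = inj₁ ≤-refl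
    lt-α (suc j) up = inj₂ (s≤s (m≤n+m (suc n) j) ,
      subst (λ t → Upper β (frac (suc j + suc n) t)) (sym (m+n∸n≡m j (suc n))) up)

  ⌊α⌋-elim : FloorMulα β (suc n) h →
             ∃[ j ] (j + suc n ≡ h × βBelow h j × Lower β (frac (suc h) j))
  ⌊α⌋-elim {n} {h} fa = split (h ∸ suc n) (m∸n+n≡m (⌊α⌋-≥ fa)) fa
    where
    β<h/j : ∀ j → LtAlpha β (j + suc n) (suc n) → βBelow (j + suc n) j
    β<h/j zero    _                = tt
    β<h/j (suc j) (inj₁ h≤1+n)     = ⊥-elim (<⇒≱ (m<n+m (suc n) z<s) h≤1+n)
    β<h/j (suc j) (inj₂ (_ , up)) =
      subst (λ t → Upper β (frac (suc j + suc n) t)) (m+n∸n≡m j (suc n)) up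
    split : ∀ j → j + suc n ≡ h → FloorMulα β (suc n) h →
            ∃[ j ] (j + suc n ≡ h × βBelow h j × Lower β (frac (suc h) j))
    split j refl (lt , _ , lo) =
      j , refl , β<h/j j lt , subst (λ t → Lower β (frac (suc (j + suc n)) t)) (m+n∸n≡m j (suc n)) lo

  ⌊α⌋<2n : FloorMulα β (suc n) h → h < 2 * suc n
  ⌊α⌋<2n {n} fa with ⌊α⌋-elim fa
  ... | zero  , refl , _ , _ = m<m+n (suc n) z<s
  ... | suc j , refl , up , _ = 2s<s+m⇒s+m<2m (suc j) (suc n)
    (subst (2 * suc j <_) (*-identityʳ _) (lower-upper-cross β 2 0 (suc j + suc n) j 2<β up))
    where
    2s<s+m⇒s+m<2m : ∀ s m → 2 * s < s + m → s + m < 2 * m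
    2s<s+m⇒s+m<2m s m lt = subst (s + m <_) (cong (_+_ m) (sym (+-identityʳ m)))
      (+-monoˡ-< m (+-cancelˡ-< s s m (subst (λ t → s + t < s + m) (+-identityʳ s) lt)))

  ⌊α⌋≤⌊β⌋ : FloorMulα β n a → FloorMulβ β n b → a ≤ b
  ⌊α⌋≤⌊β⌋ {zero}  refl refl = z≤n
  ⌊α⌋≤⌊β⌋ {suc n} fa   fb   = <⇒≤ (<-≤-trans (⌊α⌋<2n fa) (⌊β⌋-≥-2n fb))

  β≮1 : ¬ Upper β (frac (suc j) j)
  β≮1 {j} up =
    <⇒≱ (subst (2 * suc j <_) (*-identityʳ (suc j)) (lower-upper-cross β 2 0 (suc j) j 2<β up))
        (m≤m+n (suc j) (suc j + 0))

  -- With h = j + n and m = k + 1, the bounds (h+1)/(j+1) < β < h/j and h/m < β < (h+1)/m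
  -- give j < m < j + 1.
  ⌊α⌋≢⌊β⌋ : FloorMulα β n h → FloorMulβ β (suc k) h → ⊥
  ⌊α⌋≢⌊β⌋ {zero} {k = k} refl fb = n≮0 (⌊β⌋-≥ {k} fb)
  ⌊α⌋≢⌊β⌋ {suc n} {k = k} fa (lo , up) with ⌊α⌋-elim fa
  ... | j , refl , β<h/j , lo′ =
    j≰k j lo β<h/j (≤-pred (*-cancelˡ-< (suc (j + suc n)) (suc k) (suc j) cross))
    where
    cross : suc (j + suc n) * suc k < suc (j + suc n) * suc j
    cross = lower-upper-cross β (suc (j + suc n)) j (suc (j + suc n)) k lo′ up
    j≰k : ∀ {h} j → Lower β (frac h k) → βBelow h j → k < j → ⊥
    j≰k zero    _ _ ()
    j≰k {h} (suc j) lo β<h/j k<1+j =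
      <⇒≱ k<1+j (≤-pred (*-cancelˡ-< h (suc j) (suc k) (lower-upper-cross β h k h j lo β<h/j)))

  ⌊α⌋-⌊β⌋-cover : ∀ h → (∃[ n ] FloorMulα β n h) ⊎ (∃[ k ] FloorMulβ β (suc k) h)
  ⌊α⌋-⌊β⌋-cover zero    = inj₁ (0 , refl)
  ⌊α⌋-⌊β⌋-cover (suc h) = scan h 0 refl tt
    where
    Covered : ℕ → Set
    Covered h = (∃[ n ] FloorMulα β n h) ⊎ (∃[ k ] FloorMulβ β (suc k) h)
    -- Scan j = 0, 1, … keeping β < h/j: either (h+1)/(j+1) < β and h = ⌊α(h − j)⌋, or
    -- h/(j+1) < β < (h+1)/(j+1) and h = ⌊β(j + 1)⌋, or β < h/(j+1) and the scan goes on;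
    -- it stops by j = h − 1, since β > 1.
    scan : ∀ {h} d j → j + suc d ≡ h → βBelow h j → Covered h
    advance : ∀ d j → Upper β (frac (j + suc d) j) → Covered (j + suc d)
    scan d j refl β<h/j with total β (frac (suc (j + suc d)) j)
    ... | inj₁ lo = inj₁ (suc d , ⌊α⌋-intro j β<h/j lo)
    ... | inj₂ up with total β (frac (j + suc d) j)
    ...   | inj₁ lo′ = inj₂ (j , lo′ , up)
    ...   | inj₂ up′ = advance d j up′
    advance zero    j up = ⊥-elim (β≮1 {j} (subst (λ t → Upper β (frac t j)) (+-comm j 1) up))
    advance (suc d) j up = scan d (suc j) (sym (+-suc j (suc d))) up

  BeattyPair : ℕ → ℕ → Set
  BeattyPair x y = ∃[ n ] ((FloorMulα β n x × FloorMulβ β n y) ⊎ (FloorMulβ β n x × FloorMulα β n y))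

  pair-sym : BeattyPair x y → BeattyPair y x
  pair-sym (n , inj₁ (fa , fb)) = n , inj₂ (fb , fa)
  pair-sym (n , inj₂ (fb , fa)) = n , inj₁ (fa , fb)

  ⌊β⌋-black : FloorMulβ β n b → Black (BeattyS β) b
  ⌊β⌋-black {zero}  refl = inj₁ refl
  ⌊β⌋-black {suc k} fb   = inj₂ (k , fb)

  pair-legal : BeattyPair x y → Legal (BeattyS β) x y
  pair-legal (_ , inj₁ (_ , fb)) = inj₂ (⌊β⌋-black fb)
  pair-legal (_ , inj₂ (fb , _)) = inj₁ (⌊β⌋-black fb)

  partner-exists : ∀ x → ∃[ y ] BeattyPair x y
  partner-exists x with ⌊α⌋-⌊β⌋-cover x
  ... | inj₁ (n , fa) with ⌊β⌋-exists n
  ...   | y , fb = y , n , inj₁ (fa , fb)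
  partner-exists x | inj₂ (k , fb) with ⌊α⌋-exists (suc k)
  ...   | y , fa = y , suc k , inj₂ (fb , fa)

  ⌊α⌋≡⌊β⌋⇒0 : FloorMulα β n h → FloorMulβ β m h → n ≡ 0 × m ≡ 0
  ⌊α⌋≡⌊β⌋⇒0 {m = zero}  fa refl = ⌊α⌋-injective fa refl , refl
  ⌊α⌋≡⌊β⌋⇒0 {m = suc k} fa fb   = ⊥-elim (⌊α⌋≢⌊β⌋ fa fb)

  partner-unique : BeattyPair x y → BeattyPair x q → y ≡ q
  partner-unique (_ , inj₁ (fa , fb)) (_ , inj₁ (fa′ , fb′)) with ⌊α⌋-injective fa fa′
  ... | refl = ⌊β⌋-unique fb fb′
  partner-unique (_ , inj₂ (fb , fa)) (_ , inj₂ (fb′ , fa′)) with ⌊β⌋-injective fb fb′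
  ... | refl = ⌊α⌋-unique fa fa′
  partner-unique (_ , inj₁ (fa , fb)) (_ , inj₂ (fb′ , fa′)) with ⌊α⌋≡⌊β⌋⇒0 fa fb′
  ... | refl , refl = trans fb (sym fa′)
  partner-unique (_ , inj₂ (fb , fa)) (_ , inj₁ (fa′ , fb′)) with ⌊α⌋≡⌊β⌋⇒0 fa′ fb
  ... | refl , refl = trans fa (sym fb′)

  pairs-independent : BeattyPair x y → Move (BeattyS β) x y x′ y′ → ¬ BeattyPair x′ y′
  pairs-independent xy (left  x′<x _) x′y = <-irrefl (partner-unique (pair-sym x′y) (pair-sym xy)) x′<x
  pairs-independent xy (right y′<y _) xy′ = <-irrefl (partner-unique xy′ xy) y′<y

  ¬below-partners : Black (BeattyS β) x → BeattyPair x p → BeattyPair y q → y < p → x < q → ⊥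
  ¬below-partners (inj₁ refl) xp _ y<p _ =
    n≮0 (subst (_ <_) (partner-unique xp (0 , inj₁ (refl , refl))) y<p)
  ¬below-partners (inj₂ (k , fb)) xp (m , yq) y<p x<q with ⌊α⌋-exists (suc k)
  ... | a , fa with partner-unique xp (suc k , inj₂ (fb , fa))
  ...   | refl with yq
  ...     | inj₂ (fby , faq) =
    <-irrefl refl (≤-<-trans (⌊α⌋≤⌊β⌋ faq fby) (<-trans (<-≤-trans y<p (⌊α⌋≤⌊β⌋ fa fb)) x<q))
  ...     | inj₁ (fay , fbq) with m <? suc k
  ...       | yes m<1+k = <-asym x<q (⌊β⌋-strictMono m<1+k fbq fb)
  ...       | no  m≮1+k = <⇒≱ y<p (⌊α⌋-monotone (≮⇒≥ m≮1+k) fa fay)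

  pairs-absorbing : Legal (BeattyS β) x y →
                    BeattyPair x y ⊎ ∃[ x′ ] ∃[ y′ ] (Move (BeattyS β) x y x′ y′ × BeattyPair x′ y′)
  pairs-absorbing {x} {y} legal with partner-exists x | partner-exists y
  ... | p , xp | q , yq with <-cmp p y
  ...   | tri≈ _ refl _ = inj₁ xp
  ...   | tri< p<y _ _ = inj₂ (x , p , right p<y (pair-legal xp) , xp)
  ...   | tri> _ _ y<p with <-cmp q x
  ...     | tri≈ _ refl _ = inj₁ (pair-sym yq)
  ...     | tri< q<x _ _ = inj₂ (q , y , left q<x (pair-legal (pair-sym yq)) , pair-sym yq)
  ...     | tri> _ _ x<q with legal
  ...       | inj₁ x-black = ⊥-elim (¬below-partners x-black xp yq y<p x<q)
  ...       | inj₂ y-black = ⊥-elim (¬below-partners y-black yq xp x<q y<p)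

theorem2 : (β : IrrationalReal) → TwoLt β → (x y : ℕ) → Legal (BeattyS β) x y →
    (IsP (BeattyS β) x y ⇔ (∃[ n ] ((FloorMulα β n x × FloorMulβ β n y) ⊎ (FloorMulβ β n x × FloorMulα β n y))))
theorem2 β 2<β x y legal = IsP⇔kernel legal
  where
  open Beatty β 2<β
  open Kernel (BeattyS β) BeattyPair pairs-independent pairs-absorbing
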